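{- Let $X$ be a finite set with a partition $\pi$, and let $\delta_1\le\delta_2\le\varepsilon(\delta_1+1)$ be nonnegative real numbers such that $\delta_1|X^{\mathrm{eq}}|\le|X^{\mathrm{neq}}|\le\delta_2|X^{\mathrm{eq}}|$. Then for every permutation $\alpha\in S_X$, the system $(X,\pi,\alpha)$ satisfies $|D|/|X|\le\varepsilon$ (property $\mathrm{L}_1(\varepsilon)$).
   Context: For $i\in X$ let $|i|$ be the cardinality of the block of $\pi$ containing $i$, and $S(i)=\ln|i|$ (Boltzmann entropy). $X^{\mathrm{eq}}$ is the set of microstates lying in a block of $\pi$ of maximal cardinality, and $X^{\mathrm{neq}}=X\setminus X^{\mathrm{eq}}$. For $\alpha\in S_X$, $D=\{i\in X:S(\alpha(i))<S(i)\}$.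
   Formalization: The parameters δ₁, δ₂ and ε range over the nonnegative rationals instead of the nonnegative reals. -}

module Defs where

open import Data.Nat as ℕ using (ℕ; _<?_; _≤?_)
open import Data.Nat.Properties using (_≟_)
open import Data.Fin using (Fin)
open import Data.Fin.Properties using (all?)
open import Data.Fin.Permutation using (Permutation′; _⟨$⟩ʳ_)
open import Data.List using (List; length; filter; allFin)
open import Data.Integer using (+_)
open import Data.Rational using (ℚ; _/_)
open import Relation.Nullary using (Dec; ¬?)

-- A finite set X is modelled as Fin n.  A partition π of X is given by a
-- block-labelling function: i and j lie in the same block iff π i ≡ π j
-- (the blocks are the nonempty fibres of π).
Partition : ℕ → Set
Partition n = Fin n → ℕ

blockSize : ∀ {n} → Partition n → Fin n → ℕ
blockSize {n} π i = length (filter (λ j → π j ≟ π i) (allFin n))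

InEq : ∀ {n} → Partition n → Fin n → Set
InEq π i = ∀ j → blockSize π j ℕ.≤ blockSize π i

inEq? : ∀ {n} (π : Partition n) (i : Fin n) → Dec (InEq π i)
inEq? π i = all? (λ j → blockSize π j ≤? blockSize π i)

cardEq : ∀ {n} → Partition n → ℕ
cardEq {n} π = length (filter (inEq? π) (allFin n))

cardNeq : ∀ {n} → Partition n → ℕ
cardNeq {n} π = length (filter (λ i → ¬? (inEq? π i)) (allFin n))

-- D = { i : S(α i) < S(i) }, with S(i) = ln |i|.  Since ln is strictly
-- increasing on positive integers, S(α i) < S(i) iff |α i| < |i|.
cardD : ∀ {n} → Partition n → Permutation′ n → ℕ
cardD {n} π α = length (filter (λ i → blockSize π (α ⟨$⟩ʳ i) <? blockSize π i) (allFin n))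

toℚ : ℕ → ℚ
toℚ m = (+ m) / 1

{-# OPTIONS --safe #-}

-- A microstate i lies in D only if |α i| < |i| ≤ max, so α i is not in X^eq;
-- as α is a bijection, |D| ≤ |X^neq|.  Then
--   |X^neq| ≤ δ₂|X^eq| ≤ ε(δ₁|X^eq| + |X^eq|) ≤ ε(|X^neq| + |X^eq|) = ε|X|.
module Submission where

open import Defs
open import Data.Nat using (ℕ)
open import Data.Fin.Permutation using (Permutation′)
open import Data.Rational using (ℚ; 0ℚ; 1ℚ; _≤_; _*_; _+_)

import Data.Nat as ℕ
import Data.Nat.Properties as ℕ
import Data.Integer as ℤ
import Data.Integer.Properties as ℤ
import Data.Rational as ℚ
import Data.Rational.Properties as ℚ
import Data.Nat.Coprimality as Coprimality
open import Algebra.Properties.CommutativeMonoid.Sum ℕ.+-0-commutativeMonoid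
  using (sum; sum-permute)
open import Data.Bool using (true; false; if_then_else_)
open import Data.Fin using (Fin; zero; suc)
open import Data.Fin.Permutation using (_⟨$⟩ʳ_)
open import Data.List using (List; []; _∷_; length; filter; allFin; tabulate)
open import Data.List.Properties using (length-tabulate)
open import Data.Vec.Functional using (Vector)
open import Function using (_∘_; id)
open import Level using (0ℓ)
open import Relation.Nullary using (yes; no; does; ¬?)
open import Relation.Unary using (Pred; Decidable)
open import Relation.Binary.PropositionalEquality
  using (_≡_; refl; sym; trans; cong; cong₂; subst₂)

toℚ≡mkℚ : ∀ m → toℚ m ≡ ℚ.mkℚ (ℤ.+ m) 0 (Coprimality.sym (Coprimality.1-coprimeTo m))
toℚ≡mkℚ m = ℚ.normalize-coprime (Coprimality.sym (Coprimality.1-coprimeTo m))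

-- With both summands in canonical form a/1 and b/1, their sum computes to (a·1 + b·1)/1.
toℚ-+ : ∀ a b → toℚ (a ℕ.+ b) ≡ toℚ a + toℚ b
toℚ-+ a b rewrite toℚ≡mkℚ a | toℚ≡mkℚ b =
  cong (ℚ._/ 1) (sym (cong₂ ℤ._+_ (ℤ.*-identityʳ (ℤ.+ a)) (ℤ.*-identityʳ (ℤ.+ b))))

toℚ-nonNeg : ∀ a → 0ℚ ≤ toℚ a
toℚ-nonNeg a rewrite toℚ≡mkℚ a = ℚ.nonNegative⁻¹ _

toℚ-mono-≤ : ∀ {a b} → a ℕ.≤ b → toℚ a ≤ toℚ b
toℚ-mono-≤ {a} {b} a≤b =
  subst₂ _≤_ (ℚ.+-identityʳ (toℚ a)) a+[b∸a]≡b (ℚ.+-monoʳ-≤ (toℚ a) (toℚ-nonNeg (b ℕ.∸ a)))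
  where
  a+[b∸a]≡b : toℚ a + toℚ (b ℕ.∸ a) ≡ toℚ b
  a+[b∸a]≡b = trans (sym (toℚ-+ a (b ℕ.∸ a))) (cong toℚ (ℕ.m+[n∸m]≡n a≤b))

m≤δ₂e⇒m≤ε[e+m] : ∀ {δ₁ δ₂ ε e m} → 0ℚ ≤ ε → 0ℚ ≤ e → δ₂ ≤ ε * (δ₁ + 1ℚ) →
                 δ₁ * e ≤ m → m ≤ δ₂ * e → m ≤ ε * (e + m)
m≤δ₂e⇒m≤ε[e+m] {δ₁} {δ₂} {ε} {e} {m} 0≤ε 0≤e δ₂≤ε[δ₁+1] δ₁e≤m m≤δ₂e = begin
  m                   ≤⟨ m≤δ₂e ⟩
  δ₂ * e              ≤⟨ ℚ.*-monoʳ-≤-nonNeg e {{ℚ.nonNegative 0≤e}} δ₂≤ε[δ₁+1] ⟩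
  ε * (δ₁ + 1ℚ) * e   ≡⟨ ℚ.*-assoc ε (δ₁ + 1ℚ) e ⟩
  ε * ((δ₁ + 1ℚ) * e) ≡⟨ cong (ε *_) [δ₁+1]e≡δ₁e+e ⟩
  ε * (δ₁ * e + e)    ≤⟨ ℚ.*-monoˡ-≤-nonNeg ε {{ℚ.nonNegative 0≤ε}} (ℚ.+-monoˡ-≤ e δ₁e≤m) ⟩
  ε * (m + e)         ≡⟨ cong (ε *_) (ℚ.+-comm m e) ⟩
  ε * (e + m)         ∎
  where
  open ℚ.≤-Reasoning
  [δ₁+1]e≡δ₁e+e : (δ₁ + 1ℚ) * e ≡ δ₁ * e + e
  [δ₁+1]e≡δ₁e+e = trans (ℚ.*-distribʳ-+ e δ₁ 1ℚ) (cong (δ₁ * e +_) (ℚ.*-identityˡ e))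

indicator : ∀ {a} {A : Set a} {P : Pred A 0ℓ} → Decidable P → A → ℕ
indicator P? x = if does (P? x) then 1 else 0

indicator-mono : ∀ {A B : Set} {P : Pred A 0ℓ} {Q : Pred B 0ℓ}
                 (P? : Decidable P) (Q? : Decidable Q) {x y} →
                 (P x → Q y) → indicator P? x ℕ.≤ indicator Q? y
indicator-mono P? Q? {x} {y} P⇒Q with P? x | Q? y
... | no _  | _     = ℕ.z≤n
... | yes _ | yes _ = ℕ.≤-refl
... | yes p | no ¬q with () ← ¬q (P⇒Q p)

sum-mono-≤ : ∀ {n} (f g : Vector ℕ n) → (∀ i → f i ℕ.≤ g i) → sum f ℕ.≤ sum g
sum-mono-≤ {ℕ.zero}  f g f≤g = ℕ.z≤n
sum-mono-≤ {ℕ.suc n} f g f≤g = ℕ.+-mono-≤ (f≤g zero) (sum-mono-≤ (f ∘ suc) (g ∘ suc) (f≤g ∘ suc))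

length-filter-tabulate : ∀ {n} {A : Set} {P : Pred A 0ℓ} (P? : Decidable P) (f : Fin n → A) →
                         length (filter P? (tabulate f)) ≡ sum (indicator P? ∘ f)
length-filter-tabulate {ℕ.zero}  P? f = refl
length-filter-tabulate {ℕ.suc n} P? f with does (P? (f zero))
... | true  = cong ℕ.suc (length-filter-tabulate P? (f ∘ suc))
... | false = length-filter-tabulate P? (f ∘ suc)

length-filter-+-length-filter-¬ : ∀ {A : Set} {P : Pred A 0ℓ} (P? : Decidable P) (xs : List A) →
  length (filter P? xs) ℕ.+ length (filter (¬? ∘ P?) xs) ≡ length xs
length-filter-+-length-filter-¬ P? [] = refl
length-filter-+-length-filter-¬ P? (x ∷ xs) with P? x
... | yes _ = cong ℕ.suc (length-filter-+-length-filter-¬ P? xs)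
... | no _  = trans (ℕ.+-suc _ _) (cong ℕ.suc (length-filter-+-length-filter-¬ P? xs))

count : ∀ {n} {P : Pred (Fin n) 0ℓ} → Decidable P → ℕ
count {n} P? = length (filter P? (allFin n))

count-+-count-¬ : ∀ {n} {P : Pred (Fin n) 0ℓ} (P? : Decidable P) → count P? ℕ.+ count (¬? ∘ P?) ≡ n
count-+-count-¬ {n} P? = trans (length-filter-+-length-filter-¬ P? (allFin n)) (length-tabulate id)

count-≤-via-permutation : ∀ {n} {P Q : Pred (Fin n) 0ℓ} (P? : Decidable P) (Q? : Decidable Q)
                          (α : Permutation′ n) → (∀ {i} → P i → Q (α ⟨$⟩ʳ i)) → count P? ℕ.≤ count Q?
count-≤-via-permutation P? Q? α P⇒Q∘α = begin
  count P?                      ≡⟨ length-filter-tabulate P? id ⟩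
  sum (indicator P?)            ≤⟨ sum-mono-≤ _ _ (λ i → indicator-mono P? Q? {i} P⇒Q∘α) ⟩
  sum (indicator Q? ∘ (α ⟨$⟩ʳ_)) ≡⟨ sum-permute (indicator Q?) α ⟨
  sum (indicator Q?)            ≡⟨ length-filter-tabulate Q? id ⟨
  count Q?                      ∎
  where open ℕ.≤-Reasoning

cardEq+cardNeq≡n : ∀ {n} (π : Partition n) → cardEq π ℕ.+ cardNeq π ≡ n
cardEq+cardNeq≡n π = count-+-count-¬ (inEq? π)

cardD≤cardNeq : ∀ {n} (π : Partition n) (α : Permutation′ n) → cardD π α ℕ.≤ cardNeq π
cardD≤cardNeq π α = count-≤-via-permutation _ (¬? ∘ inEq? π) α
  (λ {i} |αi|<|i| αi∈Eq → ℕ.<⇒≱ |αi|<|i| (αi∈Eq i))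

mainTheorem3 : (n : ℕ) (π : Partition n) (δ₁ δ₂ ε : ℚ) →
    0ℚ ≤ δ₁ → 0ℚ ≤ δ₂ → 0ℚ ≤ ε →
    δ₁ ≤ δ₂ → δ₂ ≤ ε * (δ₁ + 1ℚ) →
    δ₁ * toℚ (cardEq π) ≤ toℚ (cardNeq π) →
    toℚ (cardNeq π) ≤ δ₂ * toℚ (cardEq π) →
    (α : Permutation′ n) →
    toℚ (cardD π α) ≤ ε * toℚ n
mainTheorem3 n π δ₁ δ₂ ε _ _ 0≤ε _ δ₂≤ε[δ₁+1] δ₁eq≤neq neq≤δ₂eq α = begin
  toℚ (cardD π α)                       ≤⟨ toℚ-mono-≤ (cardD≤cardNeq π α) ⟩
  toℚ (cardNeq π)                       ≤⟨ m≤δ₂e⇒m≤ε[e+m] {δ₁} 0≤ε (toℚ-nonNeg (cardEq π))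
                                             δ₂≤ε[δ₁+1] δ₁eq≤neq neq≤δ₂eq ⟩
  ε * (toℚ (cardEq π) + toℚ (cardNeq π)) ≡⟨ cong (ε *_) (toℚ-+ (cardEq π) (cardNeq π)) ⟨
  ε * toℚ (cardEq π ℕ.+ cardNeq π)       ≡⟨ cong (λ m → ε * toℚ m) (cardEq+cardNeq≡n π) ⟩
  ε * toℚ n                             ∎
  where open ℚ.≤-Reasoning
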